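{- Let $G_1=(V_1,E_1)$ and $G_2=(V_2,E_2)$ be graphs. Then $\mathrm{thin}(G_1\circ G_2)\leq \mathrm{indthin}(G_1\circ G_2)\leq |V_1|\,\mathrm{indthin}(G_2)$ and $\mathrm{pthin}(G_1\circ G_2)\leq \mathrm{indpthin}(G_1\circ G_2)\leq |V_1|\,\mathrm{indpthin}(G_2)$.
   Context: Graphs are finite, simple, undirected (loopless). The hom-product $G_1\circ G_2$ has vertex set $V_1\times V_2$, and $(u_1,u_2)$, $(v_1,v_2)$ are adjacent iff $u_1\neq v_1$ and either $u_1v_1\notin E_1$ or $u_2v_2\in E_2$. For a graph $G=(V,E)$, an ordering $v_1,\dots,v_n$ of $V$ and a partition of $V$ are consistent if for every $r<s<t$, whenever $v_r,v_s$ are in the same class and $v_tv_r\in E$, then $v_tv_s\in E$; strongly consistent if moreover for every $r<s<t$, whenever $v_s,v_t$ are in the same class and $v_tv_r\in E$, then $v_sv_r\in E$. $\mathrm{thin}(G)$ (resp. $\mathrm{pthin}(G)$) is the minimum number of classes of a partition of $V$ consistent (resp. strongly consistent) with some ordering of $V$; $\mathrm{indthin}$ (resp. $\mathrm{indpthin}$) is the same minimum when each class is additionally required to be an independent set. -}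

module Defs where

open import Data.Nat using (ℕ; _≤_; _<_)
open import Data.Fin using (Fin) renaming (_<_ to _<ᶠ_)
open import Data.Fin.Properties using () renaming (_≟_ to _≟ᶠ_)
open import Data.Product using (Σ; ∃; _×_; _,_; proj₁; proj₂)
open import Data.Sum using (_⊎_; inj₁; inj₂)
open import Data.Empty using (⊥)
open import Relation.Nullary using (¬_; Dec; yes; no)
open import Relation.Nullary.Decidable using (¬?; _×-dec_; _⊎-dec_)
open import Relation.Binary.PropositionalEquality using (_≡_; refl; sym)
open import Function.Bundles using (_⤖_; Bijection)

record Graph (V : Set) : Set₁ where
  field
    Adj    : V → V → Set
    symm   : ∀ {u v} → Adj u v → Adj v u
    irrefl : ∀ {u} → ¬ Adj u u
    dec    : ∀ u v → Dec (Adj u v)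
open Graph public

homAdj : ∀ {V₁ V₂} → Graph V₁ → Graph V₂ → V₁ × V₂ → V₁ × V₂ → Set
homAdj G₁ G₂ (u₁ , u₂) (v₁ , v₂) =
  ¬ (u₁ ≡ v₁) × (¬ Adj G₁ u₁ v₁ ⊎ Adj G₂ u₂ v₂)

_∘ₕ_ : ∀ {n₁ n₂} → Graph (Fin n₁) → Graph (Fin n₂) → Graph (Fin n₁ × Fin n₂)
Adj (G₁ ∘ₕ G₂) = homAdj G₁ G₂
symm (G₁ ∘ₕ G₂) (ne , inj₁ na) = (λ e → ne (sym e)) , inj₁ (λ a → na (symm G₁ a))
symm (G₁ ∘ₕ G₂) (ne , inj₂ a)  = (λ e → ne (sym e)) , inj₂ (symm G₂ a)
irrefl (G₁ ∘ₕ G₂) (ne , _) = ne refl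
dec (G₁ ∘ₕ G₂) (u₁ , u₂) (v₁ , v₂) =
  ¬? (u₁ ≟ᶠ v₁) ×-dec (¬? (dec G₁ u₁ v₁) ⊎-dec dec G₂ u₂ v₂)

Ordering : Set → ℕ → Set
Ordering V m = V ⤖ Fin m

-- A partition of V into (at most) k classes: a class-assignment map.
-- (Empty classes can be discarded, so minimising k over such maps gives
-- the minimum number of classes.)
Partition : Set → ℕ → Set
Partition V k = V → Fin k

module _ {V : Set} (G : Graph V) {m k : ℕ} (ord : Ordering V m) (c : Partition V k) where
  private
    pos : V → Fin m
    pos = Bijection.to ord

  Consistent : Set
  Consistent = ∀ r s t → pos r <ᶠ pos s → pos s <ᶠ pos t →
    c r ≡ c s → Adj G t r → Adj G t s

  StronglyConsistent : Set
  StronglyConsistent = Consistent × (∀ r s t → pos r <ᶠ pos s → pos s <ᶠ pos t →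
    c s ≡ c t → Adj G t r → Adj G s r)

  IndependentClasses : Set
  IndependentClasses = ∀ u v → c u ≡ c v → ¬ Adj G u v

ThinWith : ∀ {V} → Graph V → ℕ → Set
ThinWith {V} G k = Σ ℕ λ m → Σ (Ordering V m) λ ord → Σ (Partition V k) λ c →
  Consistent G ord c

IndThinWith : ∀ {V} → Graph V → ℕ → Set
IndThinWith {V} G k = Σ ℕ λ m → Σ (Ordering V m) λ ord → Σ (Partition V k) λ c →
  Consistent G ord c × IndependentClasses G ord c

PThinWith : ∀ {V} → Graph V → ℕ → Set
PThinWith {V} G k = Σ ℕ λ m → Σ (Ordering V m) λ ord → Σ (Partition V k) λ c →
  StronglyConsistent G ord c

IndPThinWith : ∀ {V} → Graph V → ℕ → Set
IndPThinWith {V} G k = Σ ℕ λ m → Σ (Ordering V m) λ ord → Σ (Partition V k) λ c →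
  StronglyConsistent G ord c × IndependentClasses G ord c

IsMin : (ℕ → Set) → ℕ → Set
IsMin P k = P k × (∀ j → P j → k ≤ j)

IsThin IsIndThin IsPThin IsIndPThin : ∀ {V} → Graph V → ℕ → Set
IsThin G = IsMin (ThinWith G)
IsIndThin G = IsMin (IndThinWith G)
IsPThin G = IsMin (PThinWith G)
IsIndPThin G = IsMin (IndPThinWith G)

module Submission where

-- Given an ordering ord₂ of G₂ and a partition c₂ of V₂ into k independent
-- classes that is (strongly) consistent with ord₂, order V₁ × V₂
-- lexicographically with the G₂-position as major key, and put (a , u) in
-- the class (a , c₂ u).  These n₁ * k classes are independent in G₁ ∘ G₂,
-- since two vertices with the same first coordinate are never adjacent.
-- Consistency is inherited from G₂: within a class the first coordinate is
-- fixed, so a product adjacency (b , w) ~ (a , u) transfers to (a , v) as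
-- soon as the G₂-adjacency w ~ u transfers to w ~ v, and the lexicographic
-- order only guarantees a *weak* G₂-inequality for the third vertex, which
-- is enough because the G₂-classes are independent.

open import Defs
open import Data.Nat using (ℕ; _≤_; _*_)
open import Data.Fin using (Fin; combine) renaming (_<_ to _<ᶠ_; _≤_ to _≤ᶠ_)
open import Data.Product using (_×_; ∃; _,_; proj₁; proj₂)
open import Data.Sum using (_⊎_; inj₁; inj₂; map₂)
open import Data.Empty using (⊥-elim)
open import Relation.Binary.PropositionalEquality using (_≡_; refl; trans; cong; cong₂)
open import Function.Bundles using (Bijection; mk⤖)
import Data.Nat.Properties as ℕP
import Data.Fin.Properties as FP

combine-≤ˡ : ∀ {m n} {i i' : Fin m} {j j' : Fin n} →
             combine i j <ᶠ combine i' j' → i ≤ᶠ i'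
combine-≤ˡ {j = j} {j'} lt =
  ℕP.≮⇒≥ (λ i'<i → FP.<-asym lt (FP.combine-monoˡ-< j' j i'<i))

combine-cancelʳ-< : ∀ {m n} {i i' : Fin m} {j : Fin n} →
                    combine i j <ᶠ combine i' j → i <ᶠ i'
combine-cancelʳ-< lt = FP.≤∧≢⇒< (combine-≤ˡ lt) (λ { refl → FP.<-irrefl refl lt })

-- For a partition into independent classes, the consistency conditions
-- remain true when one of the two strict inequalities is weakened: the
-- new degenerate case would need an edge inside a class.
module WeakConsistency {V : Set} (G : Graph V) {m k : ℕ}
  (ord : Ordering V m) (c : Partition V k) (indep : IndependentClasses G ord c) where

  private
    pos : V → Fin m
    pos = Bijection.to ord

  ≤-split : ∀ {s t} → pos s ≤ᶠ pos t → pos s <ᶠ pos t ⊎ s ≡ t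
  ≤-split le with ℕP.m≤n⇒m<n∨m≡n le
  ... | inj₁ lt = inj₁ lt
  ... | inj₂ eq = inj₂ (Bijection.injective ord (FP.toℕ-injective eq))

  consistent-≤ : Consistent G ord c → ∀ r s t → pos r <ᶠ pos s → pos s ≤ᶠ pos t →
                 c r ≡ c s → Adj G t r → Adj G t s
  consistent-≤ cons r s t rs st crs tr with ≤-split st
  ... | inj₁ st< = cons r s t rs st< crs tr
  ... | inj₂ refl = ⊥-elim (indep r s crs (symm G tr))

  strongly-consistent-≤ : StronglyConsistent G ord c → ∀ r s t →
                          pos r ≤ᶠ pos s → pos s <ᶠ pos t →
                          c s ≡ c t → Adj G t r → Adj G s r
  strongly-consistent-≤ (_ , scons) r s t rs st cst tr with ≤-split rs
  ... | inj₁ rs< = scons r s t rs< st cst tr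
  ... | inj₂ refl = ⊥-elim (indep r t cst (symm G tr))

homAdj-lift : ∀ {V₁ V₂} (G₁ : Graph V₁) (G₂ : Graph V₂) {a b : V₁} {u v w x : V₂} →
              (Adj G₂ u w → Adj G₂ v x) → homAdj G₁ G₂ (a , u) (b , w) → homAdj G₁ G₂ (a , v) (b , x)
homAdj-lift G₁ G₂ transfer (a≢b , adj) = a≢b , map₂ transfer adj

module ProductConstruction {n₁ n₂ m₂ k₂ : ℕ} (G₁ : Graph (Fin n₁)) (G₂ : Graph (Fin n₂))
  (ord₂ : Ordering (Fin n₂) m₂) (c₂ : Partition (Fin n₂) k₂) where

  private
    pos₂ : Fin n₂ → Fin m₂
    pos₂ = Bijection.to ord₂

  pos : Fin n₁ × Fin n₂ → Fin (m₂ * n₁)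
  pos (a , u) = combine (pos₂ u) a

  ord : Ordering (Fin n₁ × Fin n₂) (m₂ * n₁)
  ord = mk⤖ {to = pos} ((λ {x} {y} → injective x y) , surjective)
    where
    injective : ∀ x y → pos x ≡ pos y → x ≡ y
    injective (a , u) (b , v) eq with FP.combine-injective (pos₂ u) a (pos₂ v) b eq
    ... | eq₂ , eq₁ = cong₂ _,_ eq₁ (Bijection.injective ord₂ eq₂)

    surjective : ∀ i → ∃ λ x → ∀ {z} → z ≡ x → pos z ≡ i
    surjective i with FP.combine-surjective {m₂} {n₁} i
    ... | j , a , eq with Bijection.surjective ord₂ j
    ... | u , hit = (a , u) , λ { refl → trans (cong (λ p → combine p a) (hit refl)) eq }

  cls : Partition (Fin n₁ × Fin n₂) (n₁ * k₂)
  cls (a , u) = combine a (c₂ u)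

  cls-independent : IndependentClasses (G₁ ∘ₕ G₂) ord cls
  cls-independent (a , u) (b , v) same (a≢b , _) =
    a≢b (FP.combine-injectiveˡ a (c₂ u) b (c₂ v) same)

  module _ (indep₂ : IndependentClasses G₂ ord₂ c₂) where
    open WeakConsistency G₂ ord₂ c₂ indep₂

    -- A class fixes the first coordinate a; the first two vertices of the
    -- triple are strictly G₂-ordered, the last two weakly.
    cls-consistent : Consistent G₂ ord₂ c₂ → Consistent (G₁ ∘ₕ G₂) ord cls
    cls-consistent cons₂ (a , u) (a' , v) (b , w) rs st same adj
      with FP.combine-injective a (c₂ u) a' (c₂ v) same
    ... | refl , cuv = homAdj-lift G₁ G₂
      (consistent-≤ cons₂ u v w (combine-cancelʳ-< rs) (combine-≤ˡ st) cuv) adj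

    -- Symmetrically, for the second condition the first two vertices are
    -- weakly G₂-ordered and the last two (same class) strictly.
    cls-strongly-consistent : StronglyConsistent G₂ ord₂ c₂ →
                              StronglyConsistent (G₁ ∘ₕ G₂) ord cls
    proj₁ (cls-strongly-consistent scons₂) = cls-consistent (proj₁ scons₂)
    proj₂ (cls-strongly-consistent scons₂) (b , w) (a , u) (a' , v) rs st same adj
      with FP.combine-injective a (c₂ u) a' (c₂ v) same
    ... | refl , cuv = homAdj-lift G₁ G₂
      (strongly-consistent-≤ scons₂ w u v (combine-≤ˡ rs) (combine-cancelʳ-< st) cuv) adj

indThin-homProduct : ∀ {n₁ n₂ k} (G₁ : Graph (Fin n₁)) (G₂ : Graph (Fin n₂)) →
                     IndThinWith G₂ k → IndThinWith (G₁ ∘ₕ G₂) (n₁ * k)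
indThin-homProduct {n₁} G₁ G₂ (m₂ , ord₂ , c₂ , cons₂ , indep₂) =
  m₂ * n₁ , ord , cls , cls-consistent indep₂ cons₂ , cls-independent
  where open ProductConstruction G₁ G₂ ord₂ c₂

indPThin-homProduct : ∀ {n₁ n₂ k} (G₁ : Graph (Fin n₁)) (G₂ : Graph (Fin n₂)) →
                      IndPThinWith G₂ k → IndPThinWith (G₁ ∘ₕ G₂) (n₁ * k)
indPThin-homProduct {n₁} G₁ G₂ (m₂ , ord₂ , c₂ , scons₂ , indep₂) =
  m₂ * n₁ , ord , cls , cls-strongly-consistent indep₂ scons₂ , cls-independent
  where open ProductConstruction G₁ G₂ ord₂ c₂

indThin⇒thin : ∀ {V} {G : Graph V} {k} → IndThinWith G k → ThinWith G k
indThin⇒thin (m , ord , c , cons , _) = m , ord , c , cons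

indPThin⇒pThin : ∀ {V} {G : Graph V} {k} → IndPThinWith G k → PThinWith G k
indPThin⇒pThin (m , ord , c , scons , _) = m , ord , c , scons

min-≤-transfer : ∀ {P Q : ℕ → Set} (f : ℕ → ℕ) {a b} →
                 (∀ {k} → P k → Q (f k)) → IsMin Q a → P b → a ≤ f b
min-≤-transfer f P⇒Q (_ , minimal) Pb = minimal _ (P⇒Q Pb)

theorem4p52 : ∀ {n₁ n₂} (G₁ : Graph (Fin n₁)) (G₂ : Graph (Fin n₂)) →
    (∀ t i i₂ → IsThin (G₁ ∘ₕ G₂) t → IsIndThin (G₁ ∘ₕ G₂) i → IsIndThin G₂ i₂ →
      t ≤ i × i ≤ n₁ * i₂)
    × (∀ p ip ip₂ → IsPThin (G₁ ∘ₕ G₂) p → IsIndPThin (G₁ ∘ₕ G₂) ip → IsIndPThin G₂ ip₂ →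
      p ≤ ip × ip ≤ n₁ * ip₂)
theorem4p52 {n₁} G₁ G₂ = thin-bounds , pthin-bounds
  where
  thin-bounds : ∀ t i i₂ → IsThin (G₁ ∘ₕ G₂) t → IsIndThin (G₁ ∘ₕ G₂) i →
                IsIndThin G₂ i₂ → t ≤ i × i ≤ n₁ * i₂
  thin-bounds _ _ _ thin indThin indThin₂ =
    min-≤-transfer (λ k → k) (indThin⇒thin {G = G₁ ∘ₕ G₂}) thin (proj₁ indThin) ,
    min-≤-transfer (n₁ *_) (indThin-homProduct G₁ G₂) indThin (proj₁ indThin₂)

  pthin-bounds : ∀ p ip ip₂ → IsPThin (G₁ ∘ₕ G₂) p → IsIndPThin (G₁ ∘ₕ G₂) ip →
                 IsIndPThin G₂ ip₂ → p ≤ ip × ip ≤ n₁ * ip₂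
  pthin-bounds _ _ _ pthin indPThin indPThin₂ =
    min-≤-transfer (λ k → k) (indPThin⇒pThin {G = G₁ ∘ₕ G₂}) pthin (proj₁ indPThin) ,
    min-≤-transfer (n₁ *_) (indPThin-homProduct G₁ G₂) indPThin (proj₁ indPThin₂)
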